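{- Let $(A,B)$ be a maximum cut of a chemical graph $G$ and $M$ the underlying multigraph of $G$ with respect to $(A,B)$. If $M$ contains an induced even cycle $\alpha_1\alpha_2\dots\alpha_{2n}$, then $G$ contains an induced cycle $a_1b_1a_2b_2\dots a_{2n}b_{2n}$ such that $\alpha_i=a_ib_i$ for every $i\in\{1,\dots,2n\}$.
   Context: Graphs are finite and simple; a chemical graph is a connected graph of maximum degree at most $3$. A cut $(A,B)$ is a partition of $V(G)$; it is maximum if the number of edges between $A$ and $B$ is maximum. The underlying multigraph $M$ has as vertices the edges of $G[A]\cup G[B]$, and for two such edges $\alpha,\beta$ it has exactly $k$ parallel edges between $\alpha$ and $\beta$, where $k$ is the number of edges of $G$ joining an endpoint of $\alpha$ to an endpoint of $\beta$. An induced cycle in $M$ is an induced sub-multigraph that is a (simple) cycle. -}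

module Defs where

open import Data.Nat using (ℕ; zero; suc; _+_; _*_; _≤_; _<ᵇ_)
open import Data.Fin using (Fin; toℕ; _≟_)
open import Data.Bool using (Bool; true; false; _∧_; _∨_; not)
open import Data.Bool.Properties using () renaming (_≟_ to _≟ᵇ_)
open import Data.List using (List; length; filterᵇ; allFin; map)
open import Data.Nat.ListAction using (sum)
open import Data.Product using (Σ; _×_; _,_; ∃)
open import Data.Sum using (_⊎_)
open import Relation.Nullary using (¬_)
open import Relation.Nullary.Decidable using (⌊_⌋)
open import Relation.Binary.PropositionalEquality using (_≡_)

record Graph (N : ℕ) : Set where
  field
    adj   : Fin N → Fin N → Bool
    sym   : ∀ u v → adj u v ≡ adj v u
    irrefl : ∀ v → adj v v ≡ false
open Graph public

countPairs : {N : ℕ} → (Fin N → Fin N → Bool) → ℕ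
countPairs {N} p =
  sum (map (λ i → length (filterᵇ (λ j → (toℕ i <ᵇ toℕ j) ∧ p i j) (allFin N))) (allFin N))

degree : {N : ℕ} → Graph N → Fin N → ℕ
degree {N} G v = length (filterᵇ (adj G v) (allFin N))

data Walk {N : ℕ} (G : Graph N) : Fin N → Fin N → Set where
  here : ∀ {u} → Walk G u u
  step : ∀ {u w v} → adj G u w ≡ true → Walk G w v → Walk G u v

Connected : {N : ℕ} → Graph N → Set
Connected G = ∀ u v → Walk G u v

Chemical : {N : ℕ} → Graph N → Set
Chemical G = Connected G × (∀ v → degree G v ≤ 3)

-- A cut (A,B): side v = true means v ∈ A, false means v ∈ B.
Cut : ℕ → Set
Cut N = Fin N → Bool

differ : Bool → Bool → Bool
differ a b = not ⌊ a ≟ᵇ b ⌋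

cutSize : {N : ℕ} → Graph N → Cut N → ℕ
cutSize G s = countPairs (λ i j → adj G i j ∧ differ (s i) (s j))

MaximumCut : {N : ℕ} → Graph N → Cut N → Set
MaximumCut {N} G s = ∀ (s' : Cut N) → cutSize G s' ≤ cutSize G s

-- Vertices of the underlying multigraph M: edges of G[A] ∪ G[B],
-- given by a pair of endpoints (an edge uv is also represented by (v,u)).
MVertex : {N : ℕ} → Graph N → Cut N → Set
MVertex {N} G s = Σ (Fin N × Fin N) λ { (u , v) → (adj G u v ≡ true) × (s u ≡ s v) }

SameEdge : {N : ℕ} → (Fin N × Fin N) → (Fin N × Fin N) → Set
SameEdge (a , b) (x , y) = ((a ≡ x) × (b ≡ y)) ⊎ ((a ≡ y) × (b ≡ x))

endpointOf : {N : ℕ} → Fin N → (Fin N × Fin N) → Bool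
endpointOf p (x , y) = ⌊ p ≟ x ⌋ ∨ ⌊ p ≟ y ⌋

mult : {N : ℕ} {G : Graph N} {s : Cut N} → MVertex G s → MVertex G s → ℕ
mult {G = G} (α , _) (β , _) =
  countPairs (λ p q → adj G p q ∧
    ((endpointOf p α ∧ endpointOf q β) ∨ (endpointOf q α ∧ endpointOf p β)))

Consec : (k : ℕ) → (i j : Fin k) → Set
Consec k i j =
    (suc (toℕ i) ≡ toℕ j) ⊎ (suc (toℕ j) ≡ toℕ i)
  ⊎ ((suc (toℕ i) ≡ k) × (toℕ j ≡ 0)) ⊎ ((suc (toℕ j) ≡ k) × (toℕ i ≡ 0))

InducedCycleM : {N : ℕ} (G : Graph N) (s : Cut N) (k : ℕ) → (Fin k → MVertex G s) → Set
InducedCycleM G s k α =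
    (3 ≤ k)
  × (∀ i j → ¬ (i ≡ j) → ¬ SameEdge (Σ.proj₁ (α i)) (Σ.proj₁ (α j)))
  × (∀ i j → Consec k i j → mult {G = G} {s} (α i) (α j) ≡ 1)
  × (∀ i j → ¬ (i ≡ j) → ¬ Consec k i j → mult {G = G} {s} (α i) (α j) ≡ 0)

InducedCycleG : {N : ℕ} (G : Graph N) (k : ℕ) → (Fin k → Fin N) → Set
InducedCycleG G k c =
    (3 ≤ k)
  × (∀ i j → c i ≡ c j → i ≡ j)
  × (∀ i j → Consec k i j → adj G (c i) (c j) ≡ true)
  × (∀ i j → ¬ (i ≡ j) → ¬ Consec k i j → adj G (c i) (c j) ≡ false)

{-# OPTIONS --safe #-}
module Submission where

-- A maximum cut is locally optimal: flipping the sides of any vertex set S loses at least as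
-- many cut edges as it gains, so among the edges leaving S, those joining vertices on the same
-- side are at most as many as those joining opposite sides. In a graph of maximum degree 3,
-- flipping one vertex shows that each vertex has at most one neighbour on its own side. Hence
-- distinct vertices of M have disjoint endpoints, and every G-edge between two of them crosses
-- the cut. Along the induced cycle of M, the single G-edge from αᵢ to αᵢ₊₁ leaves αᵢ at an
-- endpoint exit i and enters αᵢ₊₁ at an endpoint entry (i+1). If entry i = exit i, flipping
-- {entry i, exit (i-1), entry (i+1)} would gain three edges and lose at most two; so each αᵢ is
-- the edge (entry i, exit i), and entry 0, exit 0, entry 1, exit 1, … is a cycle of G. It is
-- induced because any further G-edge between endpoints would give M a second edge between
-- consecutive vertices of the cycle or an edge between non-consecutive ones.

open import Defs hiding (sym)
open import Data.Bool using (Bool; true; false; _∧_; _∨_; not; _xor_)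
open import Data.Bool.ListAction using (any)
open import Data.Bool.Properties using (∧-zeroʳ)
open import Data.Empty using (⊥; ⊥-elim)
open import Data.Fin using (Fin; toℕ; _≟_; fromℕ; fromℕ<; inject₁; cast; combine; remQuot)
  renaming (zero to fzero; suc to fsuc)
open import Data.Fin.Properties
  using (toℕ-injective; toℕ<n; toℕ-fromℕ; toℕ-fromℕ<; toℕ-inject₁; toℕ-cast; toℕ-combine;
         remQuot-combine; combine-remQuot; cast-involutive)
open import Data.List using (List; []; _∷_; length; filterᵇ; allFin; map; tabulate)
open import Data.List.Membership.Propositional using (_∈_)
open import Data.List.Relation.Unary.All using (All; []; _∷_; lookup) renaming (map to all-map)
open import Data.List.Relation.Unary.AllPairs using ([]; _∷_)
open import Data.List.Relation.Unary.Any using (here; there)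
open import Data.List.Relation.Unary.Unique.Propositional using (Unique)
open import Data.Nat using (ℕ; zero; suc; _+_; _*_; _≤_; _<_; _<ᵇ_; z≤n; s≤s; _<?_)
import Data.Nat as ℕ
open import Data.Nat.ListAction using () renaming (sum to listSum)
open import Data.Nat.Properties
  using (+-*-semiring; *-comm; *-distribʳ-+; *-distribˡ-+; *-identityˡ; *-zeroʳ; +-comm; +-identityʳ;
         +-cancelʳ-≤; +-cancelˡ-≤; +-mono-≤; +-monoʳ-≤; +-monoˡ-≤; 1+n≢n; <-irrefl; m≤m+n; m≤n+m;
         m≤n⇒m≤1+n; n<1+n; n≤1+n; suc-injective; ≤-antisym; ≤-refl; ≤-reflexive; ≤-trans; ≮⇒≥;
         module ≤-Reasoning)
open import Data.Nat.Tactic.RingSolver using (solve-∀)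
open import Algebra.Properties.Semiring.Sum +-*-semiring
  using (sum; sum-syntax; ∑-distrib-+; ∑-comm; *-distribˡ-sum; sum-cong-≗; sum-replicate-zero)
open import Data.Product using (Σ; ∃; ∃₂; _×_; _,_; proj₁; proj₂; uncurry)
open import Data.Product.Properties using (≡-dec)
open import Data.Sum using (_⊎_; inj₁; inj₂; [_,_])
open import Function using (_∘_; case_of_)
open import Relation.Nullary using (¬_; yes; no; Dec)
open import Relation.Nullary.Decidable using (⌊_⌋; _⊎-dec_; _×-dec_)
open import Relation.Binary.PropositionalEquality
  using (_≡_; _≢_; refl; sym; trans; cong; cong₂; subst; subst₂; module ≡-Reasoning)

𝟙 : Bool → ℕ
𝟙 true  = 1
𝟙 false = 0

𝟙-∧ : ∀ a b → 𝟙 (a ∧ b) ≡ 𝟙 a * 𝟙 b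
𝟙-∧ false b = refl
𝟙-∧ true  b = sym (+-identityʳ (𝟙 b))

𝟙-positive : ∀ {b} → 0 < 𝟙 b → b ≡ true
𝟙-positive {true} _ = refl

∧-true : ∀ {a b} → a ∧ b ≡ true → a ≡ true × b ≡ true
∧-true {true} {true} refl = refl , refl

∑-mono-≤ : ∀ {n} {f g : Fin n → ℕ} → (∀ i → f i ≤ g i) → (∑[ i < n ] f i) ≤ (∑[ i < n ] g i)
∑-mono-≤ {zero}  f≤g = z≤n
∑-mono-≤ {suc n} f≤g = +-mono-≤ (f≤g fzero) (∑-mono-≤ (f≤g ∘ fsuc))

∑-term-≤ : ∀ {n} (f : Fin n → ℕ) i → f i ≤ (∑[ j < n ] f j)
∑-term-≤ f fzero    = m≤m+n _ _
∑-term-≤ f (fsuc i) = ≤-trans (∑-term-≤ (f ∘ fsuc) i) (m≤n+m _ _)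

∑-two-terms-≤ : ∀ {n} (f : Fin n → ℕ) {i j} → i ≢ j → f i + f j ≤ (∑[ k < n ] f k)
∑-two-terms-≤ f {fzero}  {fzero}  0≢0 = ⊥-elim (0≢0 refl)
∑-two-terms-≤ f {fzero}  {fsuc j} _   = +-monoʳ-≤ (f fzero) (∑-term-≤ (f ∘ fsuc) j)
∑-two-terms-≤ f {fsuc i} {fzero}  _   =
  subst (_≤ sum f) (+-comm (f fzero) (f (fsuc i))) (+-monoʳ-≤ (f fzero) (∑-term-≤ (f ∘ fsuc) i))
∑-two-terms-≤ f {fsuc i} {fsuc j} i≢j =
  ≤-trans (∑-two-terms-≤ (f ∘ fsuc) (i≢j ∘ cong fsuc)) (m≤n+m _ _)

∑-positive : ∀ {n} (f : Fin n → ℕ) → 0 < (∑[ i < n ] f i) → ∃ λ i → 0 < f i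
∑-positive {suc n} f 0<∑ with f fzero in eq
... | suc _ = fzero , subst (0 <_) (sym eq) (s≤s z≤n)
... | zero  = let i , 0<fi = ∑-positive (f ∘ fsuc) 0<∑ in fsuc i , 0<fi

-- ⌊_⌋ does not compute through the map′ in the successor case of Fin's _≟_.
⌊fsuc≟fsuc⌋ : ∀ {n} (i j : Fin n) → ⌊ fsuc i ≟ fsuc j ⌋ ≡ ⌊ i ≟ j ⌋
⌊fsuc≟fsuc⌋ i j with i ≟ j
... | yes _ = refl
... | no  _ = refl

∑-δ : ∀ {n} (x : Fin n) (f : Fin n → ℕ) → (∑[ i < n ] (𝟙 ⌊ i ≟ x ⌋ * f i)) ≡ f x
∑-δ {suc n} fzero    f =
  trans (cong₂ _+_ (+-identityʳ (f fzero)) (sum-replicate-zero n)) (+-identityʳ _)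
∑-δ {suc n} (fsuc x) f =
  trans (sum-cong-≗ λ i → cong (λ b → 𝟙 b * f (fsuc i)) (⌊fsuc≟fsuc⌋ i x)) (∑-δ x (f ∘ fsuc))

∑∑-distrib-+ : ∀ {m n} (f g : Fin m → Fin n → ℕ) →
  (∑[ i < m ] ∑[ j < n ] (f i j + g i j)) ≡ (∑[ i < m ] ∑[ j < n ] f i j) + (∑[ i < m ] ∑[ j < n ] g i j)
∑∑-distrib-+ {m} {n} f g =
  trans (sum-cong-≗ λ i → ∑-distrib-+ (f i) (g i))
        (∑-distrib-+ (λ i → ∑[ j < n ] f i j) (λ i → ∑[ j < n ] g i j))

∑∑-term-≤ : ∀ {m n} (f : Fin m → Fin n → ℕ) i j → f i j ≤ (∑[ i < m ] ∑[ j < n ] f i j)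
∑∑-term-≤ {n = n} f i j = ≤-trans (∑-term-≤ (f i) j) (∑-term-≤ (λ i → ∑[ j < n ] f i j) i)

∑∑-two-terms-≤ : ∀ {m n} (f : Fin m → Fin n → ℕ) {i j i′ j′} → (i , j) ≢ (i′ , j′) →
  f i j + f i′ j′ ≤ (∑[ i < m ] ∑[ j < n ] f i j)
∑∑-two-terms-≤ {n = n} f {i} {j} {i′} {j′} ij≢i′j′ with i ≟ i′
... | yes refl = ≤-trans (∑-two-terms-≤ (f i) (ij≢i′j′ ∘ cong (i ,_))) (∑-term-≤ (λ i → ∑[ j < n ] f i j) i)
... | no  i≢i′ = ≤-trans (+-mono-≤ (∑-term-≤ (f i) j) (∑-term-≤ (f i′) j′))
                         (∑-two-terms-≤ (λ i → ∑[ j < n ] f i j) i≢i′)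

∑∑-positive : ∀ {m n} (f : Fin m → Fin n → ℕ) → 0 < (∑[ i < m ] ∑[ j < n ] f i j) → ∃₂ λ i j → 0 < f i j
∑∑-positive {n = n} f 0<∑∑ with i , 0<row ← ∑-positive (λ i → ∑[ j < n ] f i j) 0<∑∑
                         with j , 0<fij ← ∑-positive (f i) 0<row = i , j , 0<fij

module _ {m n} (P : Fin m → Fin n → Bool) where

  ∑∑𝟙≡0 : (∑[ i < m ] ∑[ j < n ] 𝟙 (P i j)) ≡ 0 → ∀ i j → P i j ≡ false
  ∑∑𝟙≡0 total≡0 i j with P i j in Pij
  ... | false = refl
  ... | true  = case subst₂ _≤_ (cong 𝟙 Pij) total≡0 (∑∑-term-≤ (λ i j → 𝟙 (P i j)) i j) of λ ()

  ∑∑𝟙≡1-witness : (∑[ i < m ] ∑[ j < n ] 𝟙 (P i j)) ≡ 1 → ∃₂ λ i j → P i j ≡ true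
  ∑∑𝟙≡1-witness total≡1
    with i , j , 0<Pij ← ∑∑-positive (λ i j → 𝟙 (P i j)) (subst (0 <_) (sym total≡1) (s≤s z≤n)) =
    i , j , 𝟙-positive 0<Pij

  ∑∑𝟙≡1-unique : (∑[ i < m ] ∑[ j < n ] 𝟙 (P i j)) ≡ 1 →
    ∀ {i j i′ j′} → P i j ≡ true → P i′ j′ ≡ true → i ≡ i′ × j ≡ j′
  ∑∑𝟙≡1-unique total≡1 {i} {j} {i′} {j′} Pij Pi′j′ with ≡-dec _≟_ _≟_ (i , j) (i′ , j′)
  ... | yes refl    = refl , refl
  ... | no  ij≢i′j′ = ⊥-elim (<-irrefl refl (subst₂ _≤_ (cong₂ _+_ (cong 𝟙 Pij) (cong 𝟙 Pi′j′)) total≡1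
                                                   (∑∑-two-terms-≤ (λ i j → 𝟙 (P i j)) ij≢i′j′)))

_∈ᵇ_ : ∀ {n} → Fin n → List (Fin n) → Bool
x ∈ᵇ xs = any (λ y → ⌊ x ≟ y ⌋) xs

∈⇒∈ᵇ : ∀ {n} {x : Fin n} {xs} → x ∈ xs → x ∈ᵇ xs ≡ true
∈⇒∈ᵇ {x = x} {y ∷ _} (here x≡y) with x ≟ y
... | yes _   = refl
... | no x≢y = ⊥-elim (x≢y x≡y)
∈⇒∈ᵇ {x = x} {y ∷ _} (there x∈ys) with x ≟ y
... | yes _ = refl
... | no  _ = ∈⇒∈ᵇ x∈ys

∉⇒∈ᵇ : ∀ {n} {x : Fin n} {xs} → All (x ≢_) xs → x ∈ᵇ xs ≡ false
∉⇒∈ᵇ [] = refl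
∉⇒∈ᵇ {x = x} {y ∷ _} (x≢y ∷ x∉ys) with x ≟ y
... | yes x≡y = ⊥-elim (x≢y x≡y)
... | no  _   = ∉⇒∈ᵇ x∉ys

∈ᵇ⇒∈ : ∀ {n} {x : Fin n} {xs} → x ∈ᵇ xs ≡ true → x ∈ xs
∈ᵇ⇒∈ {x = x} {y ∷ _} x∈ᵇxs with x ≟ y
... | yes x≡y = here x≡y
... | no  _   = there (∈ᵇ⇒∈ x∈ᵇxs)

∑-∈ᵇ : ∀ {n} {xs : List (Fin n)} → Unique xs → (f : Fin n → ℕ) →
  (∑[ i < n ] (𝟙 (i ∈ᵇ xs) * f i)) ≡ listSum (map f xs)
∑-∈ᵇ {n} [] f = sum-replicate-zero n
∑-∈ᵇ {n} {x ∷ xs} (x∉xs ∷ xs-unique) f = begin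
  (∑[ i < n ] (𝟙 (⌊ i ≟ x ⌋ ∨ i ∈ᵇ xs) * f i))
    ≡⟨ sum-cong-≗ split ⟩
  (∑[ i < n ] (𝟙 ⌊ i ≟ x ⌋ * f i + 𝟙 (i ∈ᵇ xs) * f i))
    ≡⟨ ∑-distrib-+ (λ i → 𝟙 ⌊ i ≟ x ⌋ * f i) (λ i → 𝟙 (i ∈ᵇ xs) * f i) ⟩
  (∑[ i < n ] (𝟙 ⌊ i ≟ x ⌋ * f i)) + (∑[ i < n ] (𝟙 (i ∈ᵇ xs) * f i))
    ≡⟨ cong₂ _+_ (∑-δ x f) (∑-∈ᵇ xs-unique f) ⟩
  f x + listSum (map f xs) ∎
  where
  open ≡-Reasoning
  split : ∀ i → 𝟙 (⌊ i ≟ x ⌋ ∨ i ∈ᵇ xs) * f i ≡ 𝟙 ⌊ i ≟ x ⌋ * f i + 𝟙 (i ∈ᵇ xs) * f i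
  split i with i ≟ x
  ... | no  _    = refl
  ... | yes refl rewrite ∉⇒∈ᵇ x∉xs = sym (+-identityʳ _)

listSum-map-tabulate : ∀ {A : Set} {n} (f : A → ℕ) (g : Fin n → A) →
  listSum (map f (tabulate g)) ≡ (∑[ i < n ] f (g i))
listSum-map-tabulate {n = zero}  f g = refl
listSum-map-tabulate {n = suc n} f g = cong (f (g fzero) +_) (listSum-map-tabulate f (g ∘ fsuc))

length-filterᵇ : ∀ {A : Set} (p : A → Bool) xs → length (filterᵇ p xs) ≡ listSum (map (𝟙 ∘ p) xs)
length-filterᵇ p []       = refl
length-filterᵇ p (x ∷ xs) with p x
... | true  = cong suc (length-filterᵇ p xs)
... | false = length-filterᵇ p xs

length-filterᵇ-allFin : ∀ {n} (p : Fin n → Bool) → length (filterᵇ p (allFin n)) ≡ (∑[ i < n ] 𝟙 (p i))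
length-filterᵇ-allFin {n} p = trans (length-filterᵇ p (allFin n)) (listSum-map-tabulate (𝟙 ∘ p) (λ i → i))

degree≡∑ : ∀ {N} (G : Graph N) v → degree G v ≡ (∑[ w < N ] 𝟙 (adj G v w))
degree≡∑ G v = length-filterᵇ-allFin (adj G v)

pairSum : ∀ {n} → (Fin n → Fin n → ℕ) → ℕ
pairSum {n} h = ∑[ i < n ] ∑[ j < n ] (𝟙 (toℕ i <ᵇ toℕ j) * h i j)

countPairs≡pairSum : ∀ {n} (p : Fin n → Fin n → Bool) → countPairs p ≡ pairSum (λ i j → 𝟙 (p i j))
countPairs≡pairSum {n} p =
  trans (listSum-map-tabulate (λ i → length (filterᵇ (λ j → (toℕ i <ᵇ toℕ j) ∧ p i j) (allFin n))) (λ i → i))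
        (sum-cong-≗ λ i → trans (length-filterᵇ-allFin (λ j → (toℕ i <ᵇ toℕ j) ∧ p i j))
                                (sum-cong-≗ λ j → 𝟙-∧ (toℕ i <ᵇ toℕ j) (p i j)))

pairSum-cong : ∀ {n} {f g : Fin n → Fin n → ℕ} → (∀ i j → f i j ≡ g i j) → pairSum f ≡ pairSum g
pairSum-cong f≡g = sum-cong-≗ λ i → sum-cong-≗ λ j → cong (𝟙 (toℕ i <ᵇ toℕ j) *_) (f≡g i j)

pairSum-+ : ∀ {n} (f g : Fin n → Fin n → ℕ) → pairSum (λ i j → f i j + g i j) ≡ pairSum f + pairSum g
pairSum-+ f g = trans (sum-cong-≗ λ i → sum-cong-≗ λ j → *-distribˡ-+ (𝟙 (toℕ i <ᵇ toℕ j)) (f i j) (g i j))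
  (∑∑-distrib-+ (λ i j → 𝟙 (toℕ i <ᵇ toℕ j) * f i j) (λ i j → 𝟙 (toℕ i <ᵇ toℕ j) * g i j))

<ᵇ-connex : ∀ m n → m ≢ n → 𝟙 (m <ᵇ n) + 𝟙 (n <ᵇ m) ≡ 1
<ᵇ-connex zero    zero    0≢0 = ⊥-elim (0≢0 refl)
<ᵇ-connex zero    (suc n) _   = refl
<ᵇ-connex (suc m) zero    _   = refl
<ᵇ-connex (suc m) (suc n) m≢n = <ᵇ-connex m n (m≢n ∘ cong suc)

pairSum-symmetric : ∀ {n} (h : Fin n → Fin n → ℕ) → (∀ i → h i i ≡ 0) →
  pairSum (λ i j → h i j + h j i) ≡ (∑[ i < n ] ∑[ j < n ] h i j)
pairSum-symmetric {n} h hᵢᵢ≡0 = begin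
  pairSum (λ i j → h i j + h j i)
    ≡⟨ pairSum-+ h (λ i j → h j i) ⟩
  pairSum h + (∑[ i < n ] ∑[ j < n ] (lt i j * h j i))
    ≡⟨ cong (pairSum h +_) (∑-comm (λ i j → lt i j * h j i)) ⟩
  pairSum h + (∑[ i < n ] ∑[ j < n ] (lt j i * h i j))
    ≡⟨ ∑∑-distrib-+ (λ i j → lt i j * h i j) (λ i j → lt j i * h i j) ⟨
  (∑[ i < n ] ∑[ j < n ] (lt i j * h i j + lt j i * h i j))
    ≡⟨ sum-cong-≗ (λ i → sum-cong-≗ (one-orientation i)) ⟩
  (∑[ i < n ] ∑[ j < n ] h i j) ∎
  where
  open ≡-Reasoning
  lt : Fin n → Fin n → ℕ
  lt i j = 𝟙 (toℕ i <ᵇ toℕ j)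
  one-orientation : ∀ i j → lt i j * h i j + lt j i * h i j ≡ h i j
  one-orientation i j with i ≟ j
  ... | yes refl = trans (cong₂ (λ x y → lt i i * x + lt i i * y) (hᵢᵢ≡0 i) (hᵢᵢ≡0 i))
                         (trans (cong₂ _+_ (*-zeroʳ (lt i i)) (*-zeroʳ (lt i i))) (sym (hᵢᵢ≡0 i)))
  ... | no i≢j = trans (sym (*-distribʳ-+ (h i j) (lt i j) (lt j i)))
                       (trans (cong (_* h i j) (<ᵇ-connex _ _ (i≢j ∘ toℕ-injective))) (*-identityˡ (h i j)))

countPairs-orient : ∀ {n} (p q : Fin n → Fin n → Bool) → (∀ i j → 𝟙 (p i j) ≡ 𝟙 (q i j) + 𝟙 (q j i)) →
  countPairs p ≡ (∑[ i < n ] ∑[ j < n ] 𝟙 (q i j))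
countPairs-orient {n} p q p≡q+qᵀ = begin
  countPairs p                            ≡⟨ countPairs≡pairSum p ⟩
  pairSum (λ i j → 𝟙 (p i j))             ≡⟨ pairSum-cong p≡q+qᵀ ⟩
  pairSum (λ i j → 𝟙 (q i j) + 𝟙 (q j i))
    ≡⟨ pairSum-symmetric (λ i j → 𝟙 (q i j)) (λ i → irreflexive (p≡q+qᵀ i i)) ⟩
  (∑[ i < n ] ∑[ j < n ] 𝟙 (q i j))       ∎
  where
  open ≡-Reasoning
  irreflexive : ∀ {a b} → 𝟙 a ≡ 𝟙 b + 𝟙 b → 𝟙 b ≡ 0
  irreflexive {b = false} _ = refl
  irreflexive {true}  {true}  ()
  irreflexive {false} {true}  ()

countPairs-exchange : ∀ {n} (p q p′ q′ : Fin n → Fin n → Bool) →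
  (∀ i j → 𝟙 (p i j) + 𝟙 (q i j) ≡ 𝟙 (p′ i j) + 𝟙 (q′ i j)) →
  countPairs p + countPairs q ≡ countPairs p′ + countPairs q′
countPairs-exchange p q p′ q′ pointwise = begin
  countPairs p + countPairs q
    ≡⟨ cong₂ _+_ (countPairs≡pairSum p) (countPairs≡pairSum q) ⟩
  pairSum (λ i j → 𝟙 (p i j)) + pairSum (λ i j → 𝟙 (q i j))
    ≡⟨ pairSum-+ (λ i j → 𝟙 (p i j)) (λ i j → 𝟙 (q i j)) ⟨
  pairSum (λ i j → 𝟙 (p i j) + 𝟙 (q i j))
    ≡⟨ pairSum-cong pointwise ⟩
  pairSum (λ i j → 𝟙 (p′ i j) + 𝟙 (q′ i j))
    ≡⟨ pairSum-+ (λ i j → 𝟙 (p′ i j)) (λ i j → 𝟙 (q′ i j)) ⟩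
  pairSum (λ i j → 𝟙 (p′ i j)) + pairSum (λ i j → 𝟙 (q′ i j))
    ≡⟨ cong₂ _+_ (countPairs≡pairSum p′) (countPairs≡pairSum q′) ⟨
  countPairs p′ + countPairs q′ ∎
  where open ≡-Reasoning

neighbours : ∀ {N} → Graph N → Fin N → (Fin N → Bool) → ℕ
neighbours {N} G a P = ∑[ b < N ] 𝟙 (adj G a b ∧ P b)

module _ {N} (G : Graph N) (a : Fin N) where

  neighbours-complement : ∀ P → neighbours G a P + neighbours G a (not ∘ P) ≡ degree G a
  neighbours-complement P =
    trans (sym (∑-distrib-+ (λ b → 𝟙 (adj G a b ∧ P b)) (λ b → 𝟙 (adj G a b ∧ not (P b)))))
          (trans (sum-cong-≗ λ b → split (adj G a b) (P b)) (sym (degree≡∑ G a)))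
    where
    split : ∀ e p → 𝟙 (e ∧ p) + 𝟙 (e ∧ not p) ≡ 𝟙 e
    split false _     = refl
    split true  true  = refl
    split true  false = refl

  length-≤-neighbours : ∀ {P xs} → Unique xs → All (λ b → adj G a b ≡ true × P b ≡ true) xs →
    length xs ≤ neighbours G a P
  length-≤-neighbours {P} {xs} xs-unique xs-good = begin
    length xs                      ≡⟨ length≡listSum xs ⟨
    listSum (map (λ _ → 1) xs)     ≡⟨ ∑-∈ᵇ xs-unique (λ _ → 1) ⟨
    (∑[ b < N ] (𝟙 (b ∈ᵇ xs) * 1)) ≤⟨ ∑-mono-≤ member≤good ⟩
    neighbours G a P               ∎
    where
    open ≤-Reasoning
    length≡listSum : ∀ ys → listSum (map (λ _ → 1) ys) ≡ length ys
    length≡listSum []       = refl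
    length≡listSum (_ ∷ ys) = cong suc (length≡listSum ys)
    member≤good : ∀ b → 𝟙 (b ∈ᵇ xs) * 1 ≤ 𝟙 (adj G a b ∧ P b)
    member≤good b with b ∈ᵇ xs in b∈ᵇxs
    ... | false = z≤n
    ... | true  with adj-ab , P-b ← lookup xs-good (∈ᵇ⇒∈ b∈ᵇxs) rewrite adj-ab | P-b = ≤-refl

  neighbours-+-length-≤ : ∀ {P xs} → Unique xs → All (λ b → adj G a b ≡ true × P b ≡ false) xs →
    neighbours G a P + length xs ≤ degree G a
  neighbours-+-length-≤ {P} xs-unique xs-bad = begin
    neighbours G a P + _
      ≤⟨ +-monoʳ-≤ (neighbours G a P)
                   (length-≤-neighbours xs-unique (all-map (λ (adj-ab , P-b) → adj-ab , cong not P-b) xs-bad)) ⟩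
    neighbours G a P + neighbours G a (not ∘ P)
      ≡⟨ neighbours-complement P ⟩
    degree G a ∎
    where open ≤-Reasoning

adj⇒≢ : ∀ {N} (G : Graph N) {u v} → adj G u v ≡ true → u ≢ v
adj⇒≢ G {u} uv refl = case trans (sym uv) (irrefl G u) of λ ()

-- Flipping a vertex set of a maximum cut

differ-sym : ∀ x y → differ x y ≡ differ y x
differ-sym false false = refl
differ-sym false true  = refl
differ-sym true  false = refl
differ-sym true  true  = refl

differ-≡ : ∀ {x y} → x ≡ y → differ x y ≡ false
differ-≡ {false} refl = refl
differ-≡ {true}  refl = refl

module MaxCut {N} (G : Graph N) (s : Cut N) where

  crossing : Fin N → Fin N → Bool
  crossing a b = differ (s a) (s b)

  sameSide : Fin N → Fin N → Bool
  sameSide a b = not (crossing a b)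

  flip : (Fin N → Bool) → Cut N
  flip S v = S v xor s v

  boundary : (Fin N → Bool) → (Fin N → Fin N → Bool) → ℕ
  boundary S R = ∑[ a < N ] (𝟙 (S a) * neighbours G a (λ b → not (S b) ∧ R a b))

  boundary≡countPairs : ∀ S R → (∀ a b → R a b ≡ R b a) →
    boundary S R ≡ countPairs (λ a b → (S a xor S b) ∧ (adj G a b ∧ R a b))
  boundary≡countPairs S R R-sym = sym (begin
    countPairs (λ a b → (S a xor S b) ∧ (adj G a b ∧ R a b)) ≡⟨ countPairs-orient _ leaves orient ⟩
    (∑[ a < N ] ∑[ b < N ] 𝟙 (leaves a b))                   ≡⟨ sum-cong-≗ factor ⟩
    boundary S R                                              ∎)
    where
    open ≡-Reasoning
    leaves : Fin N → Fin N → Bool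
    leaves a b = S a ∧ (adj G a b ∧ (not (S b) ∧ R a b))
    factor : ∀ a → (∑[ b < N ] 𝟙 (leaves a b)) ≡ 𝟙 (S a) * neighbours G a (λ b → not (S b) ∧ R a b)
    factor a = trans (sum-cong-≗ λ b → 𝟙-∧ (S a) (adj G a b ∧ (not (S b) ∧ R a b)))
                     (sym (*-distribˡ-sum {N} (𝟙 (S a)) (λ b → 𝟙 (adj G a b ∧ (not (S b) ∧ R a b)))))
    xor-split : ∀ x y e r → 𝟙 ((x xor y) ∧ (e ∧ r)) ≡ 𝟙 (x ∧ (e ∧ (not y ∧ r))) + 𝟙 (y ∧ (e ∧ (not x ∧ r)))
    xor-split false false _     _ = refl
    xor-split false true  _     _ = refl
    xor-split true  false _     _ = sym (+-identityʳ _)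
    xor-split true  true  false _ = refl
    xor-split true  true  true  _ = refl
    orient : ∀ a b → 𝟙 ((S a xor S b) ∧ (adj G a b ∧ R a b)) ≡ 𝟙 (leaves a b) + 𝟙 (leaves b a)
    orient a b rewrite Graph.sym G b a | R-sym b a = xor-split (S a) (S b) (adj G a b) (R a b)

  cutSize-flip : ∀ S → cutSize G (flip S) + boundary S crossing ≡ cutSize G s + boundary S sameSide
  cutSize-flip S = begin
    cutSize G (flip S) + boundary S crossing
      ≡⟨ cong (cutSize G (flip S) +_) (boundary≡countPairs S crossing crossing-sym) ⟩
    cutSize G (flip S) + countPairs (λ a b → (S a xor S b) ∧ (adj G a b ∧ crossing a b))
      ≡⟨ countPairs-exchange _ _ _ _ (λ a b → exchange (adj G a b) (S a) (S b) (s a) (s b)) ⟩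
    cutSize G s + countPairs (λ a b → (S a xor S b) ∧ (adj G a b ∧ sameSide a b))
      ≡⟨ cong (cutSize G s +_) (boundary≡countPairs S sameSide (λ a b → cong not (crossing-sym a b))) ⟨
    cutSize G s + boundary S sameSide ∎
    where
    open ≡-Reasoning
    crossing-sym : ∀ a b → crossing a b ≡ crossing b a
    crossing-sym a b = differ-sym (s a) (s b)
    exchange : ∀ e x y u v →
      𝟙 (e ∧ differ (x xor u) (y xor v)) + 𝟙 ((x xor y) ∧ (e ∧ differ u v)) ≡
      𝟙 (e ∧ differ u v) + 𝟙 ((x xor y) ∧ (e ∧ not (differ u v)))
    exchange e     false false u     v     = refl
    exchange e     true  true  false false = refl
    exchange e     true  true  false true  = refl
    exchange e     true  true  true  false = refl
    exchange e     true  true  true  true  = refl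
    exchange false true  false u     v     = refl
    exchange true  true  false false false = refl
    exchange true  true  false false true  = refl
    exchange true  true  false true  false = refl
    exchange true  true  false true  true  = refl
    exchange false false true  u     v     = refl
    exchange true  false true  false false = refl
    exchange true  false true  false true  = refl
    exchange true  false true  true  false = refl
    exchange true  false true  true  true  = refl

  boundary-sameSide≤crossing : MaximumCut G s → ∀ S → boundary S sameSide ≤ boundary S crossing
  boundary-sameSide≤crossing maximum S = +-cancelˡ-≤ (cutSize G s) _ _ (begin
    cutSize G s + boundary S sameSide        ≡⟨ cutSize-flip S ⟨
    cutSize G (flip S) + boundary S crossing ≤⟨ +-monoˡ-≤ (boundary S crossing) (maximum (flip S)) ⟩
    cutSize G s + boundary S crossing        ∎)
    where open ≤-Reasoning

  leaving : List (Fin N) → (Fin N → Fin N → Bool) → Fin N → ℕ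
  leaving xs R a = neighbours G a (λ b → not (b ∈ᵇ xs) ∧ R a b)

  leaving-sameSide≤crossing : MaximumCut G s → ∀ {xs} → Unique xs →
    listSum (map (leaving xs sameSide) xs) ≤ listSum (map (leaving xs crossing) xs)
  leaving-sameSide≤crossing maximum {xs} xs-unique =
    subst₂ _≤_ (∑-∈ᵇ xs-unique (leaving xs sameSide)) (∑-∈ᵇ xs-unique (leaving xs crossing))
      (boundary-sameSide≤crossing maximum (_∈ᵇ xs))

-- Maximum cuts of graphs of maximum degree 3

module SubcubicMaxCut {N} (G : Graph N) (s : Cut N)
  (degree≤3 : ∀ v → degree G v ≤ 3) (maximum : MaximumCut G s) where

  open MaxCut G s

  private
    escapes : ∀ {xs a b} → All (b ≢_) xs → s a ≡ s b → not (b ∈ᵇ xs) ∧ sameSide a b ≡ true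
    escapes b∉xs sab rewrite ∉⇒∈ᵇ b∉xs | differ-≡ sab = refl

    stays : ∀ {xs a b} → b ∈ xs → not (b ∈ᵇ xs) ∧ crossing a b ≡ false
    stays b∈xs rewrite ∈⇒∈ᵇ b∈xs = refl

    blocked : ∀ {xs a b} → s a ≡ s b → not (b ∈ᵇ xs) ∧ crossing a b ≡ false
    blocked {xs} {b = b} sab rewrite differ-≡ sab = ∧-zeroʳ (not (b ∈ᵇ xs))

    sides≢ : ∀ {a b} → s a ≢ s b → a ≢ b
    sides≢ sa≢sb a≡b = sa≢sb (cong s a≡b)

  same-side-neighbour-unique : ∀ {v x y} → adj G v x ≡ true → adj G v y ≡ true →
    s v ≡ s x → s v ≡ s y → x ≡ y
  same-side-neighbour-unique {v} {x} {y} vx vy svx svy with x ≟ y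
  ... | yes x≡y = x≡y
  ... | no  x≢y = ⊥-elim (<-irrefl refl (begin
    4          ≤⟨ +-monoˡ-≤ 2 (begin
      2          ≤⟨ length-≤-neighbours G v x,y-unique ((vx , escapes x∉S svx) ∷ (vy , escapes y∉S svy) ∷ []) ⟩
      gain       ≡⟨ +-identityʳ gain ⟨
      gain + 0   ≤⟨ leaving-sameSide≤crossing maximum ([] ∷ []) ⟩
      loss + 0   ≡⟨ +-identityʳ loss ⟩
      loss       ∎) ⟩
    loss + 2   ≤⟨ neighbours-+-length-≤ G v x,y-unique ((vx , blocked {S} svx) ∷ (vy , blocked {S} svy) ∷ []) ⟩
    degree G v ≤⟨ degree≤3 v ⟩
    3          ∎))
    where
    open ≤-Reasoning
    S : List (Fin N)
    S = v ∷ []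
    gain loss : ℕ
    gain = leaving S sameSide v
    loss = leaving S crossing v
    x,y-unique : Unique (x ∷ y ∷ [])
    x,y-unique = (x≢y ∷ []) ∷ [] ∷ []
    x∉S : All (x ≢_) S
    x∉S = (adj⇒≢ G vx ∘ sym) ∷ []
    y∉S : All (y ≢_) S
    y∉S = (adj⇒≢ G vy ∘ sym) ∷ []

  -- Flipping {b, x, y} gains the edges ba, xx′ and yy′, but loses no edge at b (all three
  -- neighbours of b are accounted for) and at most one edge at each of x and y.
  no-crossing-fork : ∀ {a b x y x′ y′} →
    adj G b a ≡ true → s b ≡ s a →
    adj G b x ≡ true → adj G b y ≡ true → s b ≢ s x → s b ≢ s y → x ≢ y →
    adj G x x′ ≡ true → s x ≡ s x′ → x′ ≢ y →
    adj G y y′ ≡ true → s y ≡ s y′ → y′ ≢ x → ⊥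
  no-crossing-fork {a} {b} {x} {y} {x′} {y′} ba sba bx by sb≢sx sb≢sy x≢y xx′ sxx′ x′≢y yy′ syy′ y′≢x =
    <-irrefl refl (begin
      3                                     ≤⟨ +-mono-≤ gain-b (+-mono-≤ gain-x (+-mono-≤ gain-y z≤n)) ⟩
      listSum (map (leaving S sameSide) S)  ≤⟨ leaving-sameSide≤crossing maximum S-unique ⟩
      listSum (map (leaving S crossing) S)  ≤⟨ +-mono-≤ loss-b (+-mono-≤ loss-x (+-mono-≤ loss-y z≤n)) ⟩
      2                                     ∎)
    where
    open ≤-Reasoning
    S : List (Fin N)
    S = b ∷ x ∷ y ∷ []
    b≢x : b ≢ x
    b≢x = sides≢ sb≢sx
    b≢y : b ≢ y
    b≢y = sides≢ sb≢sy
    a≢x : a ≢ x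
    a≢x = sides≢ (sb≢sx ∘ trans sba)
    a≢y : a ≢ y
    a≢y = sides≢ (sb≢sy ∘ trans sba)
    x′≢b : x′ ≢ b
    x′≢b = sides≢ (sb≢sx ∘ sym ∘ trans sxx′)
    y′≢b : y′ ≢ b
    y′≢b = sides≢ (sb≢sy ∘ sym ∘ trans syy′)
    S-unique : Unique S
    S-unique = (b≢x ∷ b≢y ∷ []) ∷ (x≢y ∷ []) ∷ [] ∷ []
    xb : adj G x b ≡ true
    xb = trans (Graph.sym G x b) bx
    yb : adj G y b ≡ true
    yb = trans (Graph.sym G y b) by
    gain-b : 1 ≤ leaving S sameSide b
    gain-b = length-≤-neighbours G b ([] ∷ [])
      ((ba , escapes ((adj⇒≢ G ba ∘ sym) ∷ a≢x ∷ a≢y ∷ []) sba) ∷ [])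
    gain-x : 1 ≤ leaving S sameSide x
    gain-x = length-≤-neighbours G x ([] ∷ [])
      ((xx′ , escapes (x′≢b ∷ (adj⇒≢ G xx′ ∘ sym) ∷ x′≢y ∷ []) sxx′) ∷ [])
    gain-y : 1 ≤ leaving S sameSide y
    gain-y = length-≤-neighbours G y ([] ∷ [])
      ((yy′ , escapes (y′≢b ∷ y′≢x ∷ (adj⇒≢ G yy′ ∘ sym) ∷ []) syy′) ∷ [])
    loss-b : leaving S crossing b ≤ 0
    loss-b = +-cancelʳ-≤ 3 _ 0 (≤-trans
      (neighbours-+-length-≤ G b ((a≢x ∷ a≢y ∷ []) ∷ (x≢y ∷ []) ∷ [] ∷ [])
        ((ba , blocked {S} sba) ∷ (bx , stays {S} (there (here refl)))
                                ∷ (by , stays {S} (there (there (here refl)))) ∷ []))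
      (degree≤3 b))
    loss-x : leaving S crossing x ≤ 1
    loss-x = +-cancelʳ-≤ 2 _ 1 (≤-trans
      (neighbours-+-length-≤ G x ((x′≢b ∷ []) ∷ [] ∷ [])
        ((xx′ , blocked {S} sxx′) ∷ (xb , stays {S} (here refl)) ∷ []))
      (degree≤3 x))
    loss-y : leaving S crossing y ≤ 1
    loss-y = +-cancelʳ-≤ 2 _ 1 (≤-trans
      (neighbours-+-length-≤ G y ((y′≢b ∷ []) ∷ [] ∷ [])
        ((yy′ , blocked {S} syy′) ∷ (yb , stays {S} (here refl)) ∷ []))
      (degree≤3 y))

-- Cyclic order

Succ : (k : ℕ) → Fin k → Fin k → Set
Succ k i j = (suc (toℕ i) ≡ toℕ j) ⊎ ((suc (toℕ i) ≡ k) × (toℕ j ≡ 0))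

module _ {k : ℕ} where

  Succ⇒Consec : ∀ {i j} → Succ k i j → Consec k i j
  Succ⇒Consec (inj₁ i+1≡j) = inj₁ i+1≡j
  Succ⇒Consec (inj₂ wrap)  = inj₂ (inj₂ (inj₁ wrap))

  Consec-sym : ∀ {i j} → Consec k i j → Consec k j i
  Consec-sym (inj₁ e)               = inj₂ (inj₁ e)
  Consec-sym (inj₂ (inj₁ e))        = inj₁ e
  Consec-sym (inj₂ (inj₂ (inj₁ e))) = inj₂ (inj₂ (inj₂ e))
  Consec-sym (inj₂ (inj₂ (inj₂ e))) = inj₂ (inj₂ (inj₁ e))

  Consec? : ∀ i j → Dec (Consec k i j)
  Consec? i j = (suc (toℕ i) ℕ.≟ toℕ j) ⊎-dec (suc (toℕ j) ℕ.≟ toℕ i)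
         ⊎-dec ((suc (toℕ i) ℕ.≟ k) ×-dec (toℕ j ℕ.≟ 0)) ⊎-dec ((suc (toℕ j) ℕ.≟ k) ×-dec (toℕ i ℕ.≟ 0))

  Consec⇒Succ : ∀ {i j} → Consec k i j → Succ k i j ⊎ Succ k j i
  Consec⇒Succ (inj₁ e)               = inj₁ (inj₁ e)
  Consec⇒Succ (inj₂ (inj₁ e))        = inj₂ (inj₁ e)
  Consec⇒Succ (inj₂ (inj₂ (inj₁ e))) = inj₁ (inj₂ e)
  Consec⇒Succ (inj₂ (inj₂ (inj₂ e))) = inj₂ (inj₂ e)

  Succ-functional : ∀ {i j j′} → Succ k i j → Succ k i j′ → j ≡ j′
  Succ-functional         (inj₁ a)       (inj₁ b)       = toℕ-injective (trans (sym a) b)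
  Succ-functional {j = j} (inj₁ a)       (inj₂ (b , _)) = ⊥-elim (<-irrefl (trans (sym a) b) (toℕ<n j))
  Succ-functional {j′ = j′} (inj₂ (a , _)) (inj₁ b)     = ⊥-elim (<-irrefl (trans (sym b) a) (toℕ<n j′))
  Succ-functional         (inj₂ (_ , a)) (inj₂ (_ , b)) = toℕ-injective (trans a (sym b))

  Succ-injective : ∀ {i i′ j} → Succ k i j → Succ k i′ j → i ≡ i′
  Succ-injective (inj₁ a)       (inj₁ b)       = toℕ-injective (suc-injective (trans a (sym b)))
  Succ-injective (inj₁ a)       (inj₂ (_ , b)) = case trans a b of λ ()
  Succ-injective (inj₂ (_ , a)) (inj₁ b)       = case trans b a of λ ()
  Succ-injective (inj₂ (a , _)) (inj₂ (b , _)) = toℕ-injective (suc-injective (trans a (sym b)))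

  Succ⇒≢ : 2 ≤ k → ∀ {i j} → Succ k i j → i ≢ j
  Succ⇒≢ _   (inj₁ i+1≡i)      refl = 1+n≢n i+1≡i
  Succ⇒≢ 2≤k (inj₂ (i+1≡k , i≡0)) refl =
    <-irrefl refl (subst (2 ≤_) (trans (sym i+1≡k) (cong suc i≡0)) 2≤k)

  private
    too-short : 3 ≤ k → k ≤ 2 → ⊥
    too-short 3≤k k≤2 = <-irrefl refl (≤-trans 3≤k k≤2)

  Succ²⇒≢ : 3 ≤ k → ∀ {h i j} → Succ k h i → Succ k i j → h ≢ j
  Succ²⇒≢ _   (inj₁ a)        (inj₁ b)         refl =
    <-irrefl (sym (trans (cong suc a) b)) (m≤n⇒m≤1+n (n<1+n _))
  Succ²⇒≢ 3≤k (inj₁ a)        (inj₂ (b , h≡0)) refl =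
    too-short 3≤k (≤-reflexive (trans (sym b) (cong suc (trans (sym a) (cong suc h≡0)))))
  Succ²⇒≢ 3≤k (inj₂ (a , i≡0)) (inj₁ b)        refl =
    too-short 3≤k (≤-reflexive (trans (sym a) (cong suc (trans (sym b) (cong suc i≡0)))))
  Succ²⇒≢ 3≤k (inj₂ (_ , i≡0)) (inj₂ (b , _))  refl =
    too-short 3≤k (m≤n⇒m≤1+n (≤-reflexive (trans (sym b) (cong suc i≡0))))

next : ∀ {k} → Fin k → Fin k
next {suc k} i with suc (toℕ i) <? suc k
... | yes i+1<k = fromℕ< i+1<k
... | no  _     = fzero

Succ-next : ∀ {k} (i : Fin k) → Succ k i (next i)
Succ-next {suc k} i with suc (toℕ i) <? suc k
... | yes i+1<k = inj₁ (sym (toℕ-fromℕ< i+1<k))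
... | no  i+1≮k = inj₂ (≤-antisym (toℕ<n i) (≮⇒≥ i+1≮k) , refl)

prev : ∀ {k} → Fin k → Fin k
prev {suc k} fzero    = fromℕ k
prev         (fsuc j) = inject₁ j

Succ-prev : ∀ {k} (j : Fin k) → Succ k (prev j) j
Succ-prev {suc k} fzero    = inj₂ (cong suc (toℕ-fromℕ k) , refl)
Succ-prev         (fsuc j) = inj₁ (cong suc (toℕ-inject₁ j))

module _ {m : ℕ} where

  pos : Fin m → Fin 2 → Fin (2 * m)
  pos i b = cast (*-comm m 2) (combine i b)

  unpos : Fin (2 * m) → Fin m × Fin 2
  unpos j = remQuot 2 (cast (*-comm 2 m) j)

  unpos-pos : ∀ i b → unpos (pos i b) ≡ (i , b)
  unpos-pos i b = trans (cong (remQuot 2) (cast-involutive (*-comm 2 m) (*-comm m 2) (combine i b)))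
                        (remQuot-combine i b)

  pos-unpos : ∀ j → uncurry pos (unpos j) ≡ j
  pos-unpos j = trans (cong (cast (*-comm m 2)) (combine-remQuot {m} 2 (cast (*-comm 2 m) j)))
                      (cast-involutive (*-comm m 2) (*-comm 2 m) j)

  pos-injective : ∀ {i b i′ b′} → pos i b ≡ pos i′ b′ → i ≡ i′ × b ≡ b′
  pos-injective {i} {b} {i′} {b′} eq
    with refl ← trans (sym (unpos-pos i b)) (trans (cong unpos eq) (unpos-pos i′ b′)) = refl , refl

  pos-view : ∀ j → ∃₂ λ i b → j ≡ pos i b
  pos-view j = proj₁ (unpos j) , proj₂ (unpos j) , sym (pos-unpos j)

  toℕ-pos : ∀ i b → toℕ (pos i b) ≡ 2 * toℕ i + toℕ b
  toℕ-pos i b = trans (toℕ-cast (*-comm m 2) (combine i b)) (toℕ-combine i b)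

  private
    double-suc : ∀ x → suc (2 * x + 0) ≡ 2 * x + 1
    double-suc = solve-∀
    double-suc-suc : ∀ x → suc (2 * x + 1) ≡ 2 * suc x + 0
    double-suc-suc = solve-∀

  toℕ-pos-suc : ∀ i → suc (toℕ (pos i fzero)) ≡ toℕ (pos i (fsuc fzero))
  toℕ-pos-suc i = trans (cong suc (toℕ-pos i fzero)) (trans (double-suc (toℕ i)) (sym (toℕ-pos i (fsuc fzero))))

  Succ-pos-inside : ∀ i → Succ (2 * m) (pos i fzero) (pos i (fsuc fzero))
  Succ-pos-inside i = inj₁ (toℕ-pos-suc i)

  Succ-pos-across : ∀ {i i′} → Succ m i i′ → Succ (2 * m) (pos i (fsuc fzero)) (pos i′ fzero)
  Succ-pos-across {i} {i′} (inj₁ i+1≡i′) = inj₁ (begin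
    suc (toℕ (pos i (fsuc fzero))) ≡⟨ cong suc (toℕ-pos i (fsuc fzero)) ⟩
    suc (2 * toℕ i + 1)            ≡⟨ double-suc-suc (toℕ i) ⟩
    2 * suc (toℕ i) + 0            ≡⟨ cong (λ x → 2 * x + 0) i+1≡i′ ⟩
    2 * toℕ i′ + 0                 ≡⟨ toℕ-pos i′ fzero ⟨
    toℕ (pos i′ fzero)             ∎)
    where open ≡-Reasoning
  Succ-pos-across {i} {i′} (inj₂ (i+1≡m , i′≡0)) =
    inj₂ ( trans (cong suc (toℕ-pos i (fsuc fzero)))
                 (trans (double-suc-suc (toℕ i)) (trans (+-identityʳ _) (cong (2 *_) i+1≡m)))
         , trans (toℕ-pos i′ fzero) (cong (λ x → 2 * x + 0) i′≡0))

  Succ-pos⁻¹ : ∀ i b i′ b′ → Succ (2 * m) (pos i b) (pos i′ b′) →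
    (i ≡ i′ × b ≡ fzero × b′ ≡ fsuc fzero) ⊎ (b ≡ fsuc fzero × b′ ≡ fzero × Succ m i i′)
  Succ-pos⁻¹ i fzero _ _ succ
    with refl , refl ← pos-injective (Succ-functional (Succ-pos-inside i) succ) = inj₁ (refl , refl , refl)
  Succ-pos⁻¹ i (fsuc fzero) _ _ succ
    with refl , refl ← pos-injective (Succ-functional (Succ-pos-across (Succ-next i)) succ) =
    inj₂ (refl , refl , Succ-next i)

-- The underlying multigraph

_∈ₑ_ : ∀ {N} → Fin N → Fin N × Fin N → Set
p ∈ₑ (u , v) = p ≡ u ⊎ p ≡ v

module _ {N} {p u v : Fin N} where

  endpointOf⇒∈ₑ : endpointOf p (u , v) ≡ true → p ∈ₑ (u , v)
  endpointOf⇒∈ₑ p∈ with p ≟ u | p ≟ v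
  ... | yes p≡u | _       = inj₁ p≡u
  ... | no  _   | yes p≡v = inj₂ p≡v

  ∈ₑ⇒endpointOf : p ∈ₑ (u , v) → endpointOf p (u , v) ≡ true
  ∈ₑ⇒endpointOf p∈ with p ≟ u | p ≟ v
  ... | yes _   | _       = refl
  ... | no  _   | yes _   = refl
  ... | no  p≢u | no  p≢v = ⊥-elim ([ p≢u , p≢v ] p∈)

∈ₑ-SameEdge : ∀ {N} {p q : Fin N} {e} → p ∈ₑ e → q ∈ₑ e → p ≢ q → SameEdge (p , q) e
∈ₑ-SameEdge (inj₁ refl) (inj₁ refl) p≢q = ⊥-elim (p≢q refl)
∈ₑ-SameEdge (inj₁ refl) (inj₂ refl) _   = inj₁ (refl , refl)
∈ₑ-SameEdge (inj₂ refl) (inj₁ refl) _   = inj₂ (refl , refl)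
∈ₑ-SameEdge (inj₂ refl) (inj₂ refl) p≢q = ⊥-elim (p≢q refl)

SameEdge-adj : ∀ {N} (G : Graph N) {p q u v} → SameEdge (p , q) (u , v) → adj G u v ≡ true → adj G p q ≡ true
SameEdge-adj G (inj₁ (refl , refl)) uv = uv
SameEdge-adj G (inj₂ (refl , refl)) uv = trans (Graph.sym G _ _) uv

SameEdge-join : ∀ {N} {d e f : Fin N × Fin N} → SameEdge d e → SameEdge d f → SameEdge e f
SameEdge-join (inj₁ (refl , refl)) (inj₁ (refl , refl)) = inj₁ (refl , refl)
SameEdge-join (inj₁ (refl , refl)) (inj₂ (refl , refl)) = inj₂ (refl , refl)
SameEdge-join (inj₂ (refl , refl)) (inj₁ (refl , refl)) = inj₂ (refl , refl)
SameEdge-join (inj₂ (refl , refl)) (inj₂ (refl , refl)) = inj₁ (refl , refl)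

module Multigraph {N} (G : Graph N) (s : Cut N) where

  links : Fin N × Fin N → Fin N × Fin N → Fin N → Fin N → Bool
  links e f p q = adj G p q ∧ (endpointOf p e ∧ endpointOf q f)

  links⇒ : ∀ {e f p q} → links e f p q ≡ true → adj G p q ≡ true × p ∈ₑ e × q ∈ₑ f
  links⇒ {_ , _} {_ , _} pq-links with pq , p∈e,q∈f ← ∧-true pq-links with p∈e , q∈f ← ∧-true p∈e,q∈f =
    pq , endpointOf⇒∈ₑ p∈e , endpointOf⇒∈ₑ q∈f

  ⇒links : ∀ {e f p q} → adj G p q ≡ true → p ∈ₑ e → q ∈ₑ f → links e f p q ≡ true
  ⇒links {_ , _} {_ , _} pq p∈e q∈f rewrite pq | ∈ₑ⇒endpointOf p∈e | ∈ₑ⇒endpointOf q∈f = refl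

  Disjoint : MVertex G s → MVertex G s → Set
  Disjoint α β = ∀ {p} → p ∈ₑ proj₁ α → p ∈ₑ proj₁ β → ⊥

  mult≡∑∑links : ∀ α β → Disjoint α β →
    mult {G = G} {s} α β ≡ (∑[ p < N ] ∑[ q < N ] 𝟙 (links (proj₁ α) (proj₁ β) p q))
  mult≡∑∑links ((u , v) , _) ((u′ , v′) , _) α∩β=∅ = countPairs-orient _ _ orient
    where
    in-α in-β : Fin N → Bool
    in-α p = endpointOf p (u , v)
    in-β p = endpointOf p (u′ , v′)
    not-both : ∀ p → in-α p ∧ in-β p ≡ false
    not-both p with in-α p in p∈α | in-β p in p∈β
    ... | false | _     = refl
    ... | true  | false = refl
    ... | true  | true  = ⊥-elim (α∩β=∅ (endpointOf⇒∈ₑ {p = p} p∈α) (endpointOf⇒∈ₑ {p = p} p∈β))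
    split : ∀ e a b c d → a ∧ b ≡ false → 𝟙 (e ∧ ((a ∧ d) ∨ (c ∧ b))) ≡ 𝟙 (e ∧ (a ∧ d)) + 𝟙 (e ∧ (c ∧ b))
    split false _     _     _     _     _ = refl
    split true  false _     _     _     _ = refl
    split true  true  false false false _ = refl
    split true  true  false false true  _ = refl
    split true  true  false true  false _ = refl
    split true  true  false true  true  _ = refl
    orient : ∀ p q → 𝟙 (adj G p q ∧ ((in-α p ∧ in-β q) ∨ (in-α q ∧ in-β p))) ≡
                     𝟙 (links (u , v) (u′ , v′) p q) + 𝟙 (links (u , v) (u′ , v′) q p)
    orient p q rewrite Graph.sym G q p = split (adj G p q) (in-α p) (in-β p) (in-α q) (in-β q) (not-both p)

  module _ {α β : MVertex G s} (α∩β=∅ : Disjoint α β) where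

    mult≡0⇒¬adj : mult {G = G} {s} α β ≡ 0 → ∀ {p q} → p ∈ₑ proj₁ α → q ∈ₑ proj₁ β → adj G p q ≡ false
    mult≡0⇒¬adj mult≡0 {p} {q} p∈α q∈β with adj G p q in pq
    ... | false = refl
    ... | true  = case trans (sym (⇒links pq p∈α q∈β))
                             (∑∑𝟙≡0 (links (proj₁ α) (proj₁ β)) (trans (sym (mult≡∑∑links α β α∩β=∅)) mult≡0) p q)
                  of λ ()

    mult≡1⇒link : mult {G = G} {s} α β ≡ 1 → ∃₂ λ p q → adj G p q ≡ true × p ∈ₑ proj₁ α × q ∈ₑ proj₁ β
    mult≡1⇒link mult≡1 with p , q , pq-links ← ∑∑𝟙≡1-witness _ (trans (sym (mult≡∑∑links α β α∩β=∅)) mult≡1) =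
      p , q , links⇒ pq-links

    mult≡1⇒link-unique : mult {G = G} {s} α β ≡ 1 → ∀ {p q p′ q′} →
      adj G p q ≡ true → p ∈ₑ proj₁ α → q ∈ₑ proj₁ β →
      adj G p′ q′ ≡ true → p′ ∈ₑ proj₁ α → q′ ∈ₑ proj₁ β → p ≡ p′ × q ≡ q′
    mult≡1⇒link-unique mult≡1 pq p∈α q∈β p′q′ p′∈α q′∈β =
      ∑∑𝟙≡1-unique _ (trans (sym (mult≡∑∑links α β α∩β=∅)) mult≡1) (⇒links pq p∈α q∈β) (⇒links p′q′ p′∈α q′∈β)

-- Lifting an induced cycle of M to G

module Lift {N} (G : Graph N) (s : Cut N) (degree≤3 : ∀ v → degree G v ≤ 3) (maximum : MaximumCut G s)
  {m} (α : Fin m → MVertex G s) (cycle : InducedCycleM G s m α) where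

  open SubcubicMaxCut G s degree≤3 maximum
  open Multigraph G s

  private
    3≤m : 3 ≤ m
    3≤m = proj₁ cycle
    2≤m : 2 ≤ m
    2≤m = ≤-trans (n≤1+n 2) 3≤m
    distinct : ∀ i j → i ≢ j → ¬ SameEdge (proj₁ (α i)) (proj₁ (α j))
    distinct = proj₁ (proj₂ cycle)
    consecutive : ∀ i j → Consec m i j → mult {G = G} {s} (α i) (α j) ≡ 1
    consecutive = proj₁ (proj₂ (proj₂ cycle))
    non-consecutive : ∀ i j → i ≢ j → ¬ Consec m i j → mult {G = G} {s} (α i) (α j) ≡ 0
    non-consecutive = proj₂ (proj₂ (proj₂ cycle))

  _∈α_ : Fin N → Fin m → Set
  p ∈α i = p ∈ₑ proj₁ (α i)

  record Partner (p : Fin N) (i : Fin m) : Set where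
    field
      other     : Fin N
      other∈    : other ∈α i
      adjacent  : adj G p other ≡ true
      same-side : s p ≡ s other
      same-edge : SameEdge (p , other) (proj₁ (α i))

  partner : ∀ {p i} → p ∈α i → Partner p i
  partner {i = i} (inj₁ refl) = record
    { other = proj₂ (proj₁ (α i)) ; other∈ = inj₂ refl ; adjacent = proj₁ (proj₂ (α i))
    ; same-side = proj₂ (proj₂ (α i)) ; same-edge = inj₁ (refl , refl) }
  partner {i = i} (inj₂ refl) = record
    { other = proj₁ (proj₁ (α i)) ; other∈ = inj₁ refl
    ; adjacent = trans (Graph.sym G _ _) (proj₁ (proj₂ (α i)))
    ; same-side = sym (proj₂ (proj₂ (α i))) ; same-edge = inj₂ (refl , refl) }

  endpoints-disjoint : ∀ {i j} → i ≢ j → Disjoint (α i) (α j)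
  endpoints-disjoint {i} {j} i≢j {p} p∈i p∈j =
    distinct i j i≢j
      (SameEdge-join (same-edge pᵢ) (subst (λ q → SameEdge (p , q) _) (sym same-other) (same-edge pⱼ)))
    where
    open Partner
    pᵢ : Partner p i
    pᵢ = partner p∈i
    pⱼ : Partner p j
    pⱼ = partner p∈j
    same-other : other pᵢ ≡ other pⱼ
    same-other = same-side-neighbour-unique (adjacent pᵢ) (adjacent pⱼ) (same-side pᵢ) (same-side pⱼ)

  endpoints-adjacent : ∀ {i p q} → p ∈α i → q ∈α i → p ≢ q → adj G p q ≡ true
  endpoints-adjacent {i} p∈i q∈i p≢q = SameEdge-adj G (∈ₑ-SameEdge p∈i q∈i p≢q) (proj₁ (proj₂ (α i)))

  crossing-between : ∀ {i j p q} → i ≢ j → p ∈α i → q ∈α j → adj G p q ≡ true → s p ≢ s q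
  crossing-between {i} {p = p} {q} i≢j p∈i q∈j pq sp≡sq =
    endpoints-disjoint i≢j (subst (_∈α i) partner≡q (other∈ pᵢ)) q∈j
    where
    open Partner
    pᵢ : Partner p i
    pᵢ = partner p∈i
    partner≡q : other pᵢ ≡ q
    partner≡q = same-side-neighbour-unique (adjacent pᵢ) pq (same-side pᵢ) sp≡sq

  record Link (i j : Fin m) : Set where
    field
      source   : Fin N
      target   : Fin N
      adjacent : adj G source target ≡ true
      source∈  : source ∈α i
      target∈  : target ∈α j

  -- Opaque: only the fields of a link are used, and unfolding the counting argument behind it
  -- makes type checking very slow.
  opaque
    link : ∀ {i j} → Succ m i j → Link i j
    link {i} {j} i→j =
      let p , q , pq , p∈i , q∈j = mult≡1⇒link {α i} {α j} (endpoints-disjoint (Succ⇒≢ 2≤m i→j))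
                                     (consecutive i j (Succ⇒Consec i→j))
      in record { source = p ; target = q ; adjacent = pq ; source∈ = p∈i ; target∈ = q∈j }

  link-unique : ∀ {i j p q p′ q′} → Succ m i j →
    adj G p q ≡ true → p ∈α i → q ∈α j → adj G p′ q′ ≡ true → p′ ∈α i → q′ ∈α j → p ≡ p′ × q ≡ q′
  link-unique {i} {j} i→j =
    mult≡1⇒link-unique {α i} {α j} (endpoints-disjoint (Succ⇒≢ 2≤m i→j)) (consecutive i j (Succ⇒Consec i→j))

  unlinked : ∀ {i j p q} → i ≢ j → ¬ Consec m i j → p ∈α i → q ∈α j → adj G p q ≡ false
  unlinked {i} {j} i≢j ¬i~j = mult≡0⇒¬adj {α i} {α j} (endpoints-disjoint i≢j) (non-consecutive i j i≢j ¬i~j)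

  open Link

  exit : Fin m → Fin N
  exit i = source (link (Succ-next i))

  entry : Fin m → Fin N
  entry j = target (link (Succ-prev j))

  exit∈ : ∀ i → exit i ∈α i
  exit∈ i = source∈ (link (Succ-next i))

  entry∈ : ∀ j → entry j ∈α j
  entry∈ j = target∈ (link (Succ-prev j))

  exit-entry-unique : ∀ {i j p q} → Succ m i j → adj G p q ≡ true → p ∈α i → q ∈α j → p ≡ exit i × q ≡ entry j
  exit-entry-unique {i} {j} i→j pq p∈i q∈j =
      proj₁ (link-unique i→j pq p∈i q∈j (adjacent out) (source∈ out)
                         (subst (target out ∈α_) (Succ-functional (Succ-next i) i→j) (target∈ out)))
    , proj₂ (link-unique i→j pq p∈i q∈j (adjacent into)
                         (subst (source into ∈α_) (Succ-injective (Succ-prev j) i→j) (source∈ into)) (target∈ into))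
    where
    out : Link i (next i)
    out = link (Succ-next i)
    into : Link (prev j) j
    into = link (Succ-prev j)

  exit-entry : ∀ {i j} → Succ m i j → adj G (exit i) (entry j) ≡ true
  exit-entry {i} {j} i→j = subst (λ q → adj G (exit i) q ≡ true) target≡entry (adjacent out)
    where
    out : Link i (next i)
    out = link (Succ-next i)
    target≡entry : target out ≡ entry j
    target≡entry = proj₂ (exit-entry-unique i→j (adjacent out) (source∈ out)
                                            (subst (target out ∈α_) (Succ-functional (Succ-next i) i→j) (target∈ out)))

  -- Otherwise entry j, with its neighbours exit (prev j) and entry (next j), is a crossing fork.
  entry≢exit : ∀ j → entry j ≢ exit j
  entry≢exit j entry≡exit =
    no-crossing-fork (adjacent′ a) (same-side a) bx by sb≢sx sb≢sy x≢y
                     (adjacent′ x′) (same-side x′) x′≢y (adjacent′ y′) (same-side y′) y′≢x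
    where
    open Partner renaming (adjacent to adjacent′)
    h→j : Succ m (prev j) j
    h→j = Succ-prev j
    j→l : Succ m j (next j)
    j→l = Succ-next j
    h≢l : prev j ≢ next j
    h≢l = Succ²⇒≢ 3≤m h→j j→l
    a : Partner (entry j) j
    a = partner (entry∈ j)
    x′ : Partner (exit (prev j)) (prev j)
    x′ = partner (exit∈ (prev j))
    y′ : Partner (entry (next j)) (next j)
    y′ = partner (entry∈ (next j))
    bx : adj G (entry j) (exit (prev j)) ≡ true
    bx = trans (Graph.sym G _ _) (exit-entry h→j)
    by : adj G (entry j) (entry (next j)) ≡ true
    by = subst (λ b → adj G b (entry (next j)) ≡ true) (sym entry≡exit) (exit-entry j→l)
    sb≢sx : s (entry j) ≢ s (exit (prev j))
    sb≢sx = crossing-between (Succ⇒≢ 2≤m h→j) (exit∈ (prev j)) (entry∈ j) (exit-entry h→j) ∘ sym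
    sb≢sy : s (entry j) ≢ s (entry (next j))
    sb≢sy = crossing-between (Succ⇒≢ 2≤m j→l) (exit∈ j) (entry∈ (next j)) (exit-entry j→l)
          ∘ trans (cong s (sym entry≡exit))
    x≢y : exit (prev j) ≢ entry (next j)
    x≢y e = endpoints-disjoint h≢l (exit∈ (prev j)) (subst (_∈α next j) (sym e) (entry∈ (next j)))
    x′≢y : other x′ ≢ entry (next j)
    x′≢y e = endpoints-disjoint h≢l (other∈ x′) (subst (_∈α next j) (sym e) (entry∈ (next j)))
    y′≢x : other y′ ≢ exit (prev j)
    y′≢x e = endpoints-disjoint h≢l (exit∈ (prev j)) (subst (_∈α next j) e (other∈ y′))

  corner : Fin m → Fin 2 → Fin N
  corner i fzero        = entry i
  corner i (fsuc fzero) = exit i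

  corner∈ : ∀ i b → corner i b ∈α i
  corner∈ i fzero        = entry∈ i
  corner∈ i (fsuc fzero) = exit∈ i

  corner-injective : ∀ i b i′ b′ → corner i b ≡ corner i′ b′ → i ≡ i′ × b ≡ b′
  corner-injective i b i′ b′ eq with i ≟ i′
  ... | no  i≢i′ = ⊥-elim (endpoints-disjoint i≢i′ (corner∈ i b) (subst (_∈α i′) (sym eq) (corner∈ i′ b′)))
  corner-injective i fzero        _ fzero        eq | yes refl = refl , refl
  corner-injective i (fsuc fzero) _ (fsuc fzero) eq | yes refl = refl , refl
  corner-injective i fzero        _ (fsuc fzero) eq | yes refl = ⊥-elim (entry≢exit i eq)
  corner-injective i (fsuc fzero) _ fzero        eq | yes refl = ⊥-elim (entry≢exit i (sym eq))

  liftedCycle : Fin (2 * m) → Fin N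
  liftedCycle j = uncurry corner (unpos j)

  liftedCycle-pos : ∀ i b → liftedCycle (pos i b) ≡ corner i b
  liftedCycle-pos i b = cong (uncurry corner) (unpos-pos i b)

  liftedCycle-injective : ∀ j k → liftedCycle j ≡ liftedCycle k → j ≡ k
  liftedCycle-injective j k eq with i , b , refl ← pos-view {m} j with i′ , b′ , refl ← pos-view {m} k
    with refl , refl ← corner-injective i b i′ b′
                         (trans (sym (liftedCycle-pos i b)) (trans eq (liftedCycle-pos i′ b′))) = refl

  consecutive-corners-adjacent : ∀ i b i′ b′ → Succ (2 * m) (pos i b) (pos i′ b′) →
    adj G (corner i b) (corner i′ b′) ≡ true
  consecutive-corners-adjacent i b i′ b′ succ with Succ-pos⁻¹ i b i′ b′ succ
  ... | inj₁ (refl , refl , refl) = endpoints-adjacent (entry∈ _) (exit∈ _) (entry≢exit _)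
  ... | inj₂ (refl , refl , i→i′) = exit-entry i→i′

  liftedCycle-adjacent : ∀ j k → Consec (2 * m) j k → adj G (liftedCycle j) (liftedCycle k) ≡ true
  liftedCycle-adjacent j k j~k with i , b , refl ← pos-view {m} j with i′ , b′ , refl ← pos-view {m} k
    rewrite liftedCycle-pos i b | liftedCycle-pos i′ b′ with Consec⇒Succ j~k
  ... | inj₁ j→k = consecutive-corners-adjacent i b i′ b′ j→k
  ... | inj₂ k→j = trans (Graph.sym G _ _) (consecutive-corners-adjacent i′ b′ i b k→j)

  linked-corners-exit-entry : ∀ {i i′} b b′ → Succ m i i′ → adj G (corner i b) (corner i′ b′) ≡ true →
    b ≡ fsuc fzero × b′ ≡ fzero
  linked-corners-exit-entry {i} {i′} b b′ i→i′ adjacent =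
    proj₂ (corner-injective i b i (fsuc fzero) (proj₁ at-exit-entry)) ,
    proj₂ (corner-injective i′ b′ i′ fzero (proj₂ at-exit-entry))
    where
    at-exit-entry : corner i b ≡ exit i × corner i′ b′ ≡ entry i′
    at-exit-entry = exit-entry-unique i→i′ adjacent (corner∈ i b) (corner∈ i′ b′)

  adjacent-corners-consecutive : ∀ i b i′ b′ → adj G (corner i b) (corner i′ b′) ≡ true →
    Consec (2 * m) (pos i b) (pos i′ b′)
  adjacent-corners-consecutive i b i′ b′ adjacent with i ≟ i′
  adjacent-corners-consecutive i fzero        _ fzero        adjacent | yes refl =
    ⊥-elim (adj⇒≢ G adjacent refl)
  adjacent-corners-consecutive i fzero        _ (fsuc fzero) adjacent | yes refl =
    Succ⇒Consec (Succ-pos-inside i)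
  adjacent-corners-consecutive i (fsuc fzero) _ fzero        adjacent | yes refl =
    Consec-sym (Succ⇒Consec (Succ-pos-inside i))
  adjacent-corners-consecutive i (fsuc fzero) _ (fsuc fzero) adjacent | yes refl =
    ⊥-elim (adj⇒≢ G adjacent refl)
  ... | no i≢i′ with Consec? i i′
  ...   | no ¬i~i′ = case trans (sym adjacent) (unlinked i≢i′ ¬i~i′ (corner∈ i b) (corner∈ i′ b′)) of λ ()
  ...   | yes i~i′ with Consec⇒Succ i~i′
  ...     | inj₁ i→i′ with refl , refl ← linked-corners-exit-entry b b′ i→i′ adjacent =
    Succ⇒Consec (Succ-pos-across i→i′)
  ...     | inj₂ i′→i with refl , refl ← linked-corners-exit-entry b′ b i′→i (trans (Graph.sym G _ _) adjacent) =
    Consec-sym (Succ⇒Consec (Succ-pos-across i′→i))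

  liftedCycle-nonadjacent : ∀ j k → j ≢ k → ¬ Consec (2 * m) j k → adj G (liftedCycle j) (liftedCycle k) ≡ false
  liftedCycle-nonadjacent j k _ ¬j~k with adj G (liftedCycle j) (liftedCycle k) in jk
  ... | false = refl
  ... | true with i , b , refl ← pos-view {m} j with i′ , b′ , refl ← pos-view {m} k =
    ⊥-elim (¬j~k (adjacent-corners-consecutive i b i′ b′
                   (subst₂ (λ x y → adj G x y ≡ true) (liftedCycle-pos i b) (liftedCycle-pos i′ b′) jk)))

  liftedCycle-edges : ∀ i j k → toℕ j ≡ 2 * toℕ i → toℕ k ≡ 1 + toℕ j →
    SameEdge (liftedCycle j , liftedCycle k) (proj₁ (α i))
  liftedCycle-edges i j k j≡2i k≡1+j
    with refl ← toℕ-injective {i = j} {pos i fzero} (trans j≡2i (sym (trans (toℕ-pos i fzero) (+-identityʳ _))))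
    with refl ← toℕ-injective {i = k} {pos i (fsuc fzero)} (trans k≡1+j (toℕ-pos-suc i))
    rewrite liftedCycle-pos i fzero | liftedCycle-pos i (fsuc fzero) =
    ∈ₑ-SameEdge (entry∈ i) (exit∈ i) (entry≢exit i)

  liftedCycle-induced : InducedCycleG G (2 * m) liftedCycle
  liftedCycle-induced =
    ≤-trans 3≤m (m≤m+n m (m + 0)) , liftedCycle-injective , liftedCycle-adjacent , liftedCycle-nonadjacent

lift-induced-cycle : ∀ {N} (G : Graph N) (s : Cut N) → (∀ v → degree G v ≤ 3) → MaximumCut G s →
  ∀ {m} (α : Fin m → MVertex G s) → InducedCycleM G s m α →
  Σ (Fin (2 * m) → Fin N) λ c → InducedCycleG G (2 * m) c ×
    (∀ i j k → toℕ j ≡ 2 * toℕ i → toℕ k ≡ 1 + toℕ j → SameEdge (c j , c k) (proj₁ (α i)))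
lift-induced-cycle G s degree≤3 maximum α cycle = liftedCycle , liftedCycle-induced , liftedCycle-edges
  where open Lift G s degree≤3 maximum α cycle

lemma4p11 : {N : ℕ} (G : Graph N) (s : Cut N) → Chemical G → MaximumCut G s →
    (n : ℕ) → 2 ≤ n → (α : Fin (2 * n) → MVertex G s) → InducedCycleM G s (2 * n) α →
    Σ (Fin (2 * (2 * n)) → Fin N) λ c → InducedCycleG G (2 * (2 * n)) c ×
      (∀ (i : Fin (2 * n)) (j k : Fin (2 * (2 * n))) → toℕ j ≡ 2 * toℕ i →
        toℕ k ≡ 1 + toℕ j → SameEdge (c j , c k) (proj₁ (α i)))
lemma4p11 G s (_ , degree≤3) maximum n _ α cycle = lift-induced-cycle G s degree≤3 maximum α cycle
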